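{- Let $q>2$ be a prime power, $n\ge 3$, and let $(\Omega,\{R_0,\dots,R_4\})$ be the association scheme on the points of $\mathsf{Q}^-(2n-1,q)$ outside a nondegenerate hyperplane $\Pi$ defined in the context. This association scheme is not metric (with respect to any ordering of its relations). It is cometric if and only if $n=3$, and when $n=3$ there is exactly one cometric ordering of its minimal idempotents, namely the ordering $E_0,\dots,E_4$ described in the context.
   Context: Let $\Omega$ be the set of points of $\mathsf{Q}^-(2n-1,q)$ not in a fixed hyperplane $\Pi$ with nondegenerate section. With $\perp$ the polarity of the quadric, for $P\in\Omega$ the line through $P$ and the pole $\Pi^\perp$ meets the quadric in exactly two points, and $P^\sigma$ denotes the one other than $P$. Write $X\sim Y$ if $X\ne Y$ and $X,Y$ are collinear on the quadric. Relations: $R_0$ identity; $R_1=\{(X,Y):Y\not\sim X,\ X\sim Y^\sigma\}$; $R_2=\{(X,Y):Y\not\sim X,\ X\not\sim Y^\sigma\}$; $R_3=\{(X,Y):Y\sim X,\ X\not\sim Y^\sigma\}$; $R_4=\{(X,Y):X=Y^\sigma\}$. This is an association scheme whose minimal idempotents $E_0=\frac1{|\Omega|}J,E_1,\dots,E_4$ are ordered so that the eigenvalue of the adjacency matrix of $R_\ell$ on the column space of $E_i$ is the $(i,\ell)$ entry of \[ \begin{bmatrix} 1 & ( q^{n-2}-1)(q^{n-1}+1) & q^{n-2} ( q-2) (q^{n-1}+1) & ( q^{n-2}-1)(q^{n-1}+1) & 1\\ 1 & {q}^{n-1}+1 & 0 & -( {q}^{n-1}+1) & -1\\ 1 & q^{n-2}-1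 & -2q^{n-2} & q^{n-2}-1 & 1\\ 1 & -( q^{n-2}-1) & 0 & q^{n-2}-1 & -1\\ 1 &-q^{n - 2}(q - 2)-1& 2q^{n-2}( q-2) & -q^{n - 2}(q - 2)-1& 1 \end{bmatrix}. \] A scheme is metric with respect to an ordering $R_0,\dots,R_d$ if its intersection numbers satisfy $p_{ij}^h=0$ when $i+j<h$ or $h<|i-j|$ and $p_{ij}^{i+j}\ne0$ when $i+j\le d$; it is cometric ($Q$-polynomial) with respect to an ordering $E_0,\dots,E_d$ if the Krein parameters (defined by $E_i\circ E_j=\frac1{|\Omega|}\sum_hq_{ij}^hE_h$) satisfy $q_{ij}^h=0$ when $i+j<h$ or $h<|i-j|$, and $q_{ij}^{i+j}\ne0$ when $i+j\le d$. -}

module Defs where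

open import Data.Nat as ℕ using (ℕ; _^_; _∸_; _≤_; _<_; ∣_-_∣)
open import Data.Nat.Primality using (Prime)
open import Data.Integer as Int using (ℤ; +_; +0; +[1+_]; -[1+_])
open import Data.Rational as Rat using (ℚ; mkℚ; 0ℚ; 1/_) renaming (_/_ to _÷ℤ_)
open import Data.Fin using (Fin; zero; suc; toℕ)
open import Data.Fin.Permutation using (Permutation′; _⟨$⟩ʳ_)
open import Data.Product using (Σ; _×_)
open import Data.Sum using (_⊎_)
open import Relation.Binary.PropositionalEquality using (_≡_; _≢_)

IsPrimePower : ℕ → Set
IsPrimePower q = Σ ℕ λ p → Σ ℕ λ k → Prime p × q ≡ p ^ ℕ.suc k

-- total reciprocal on ℚ (1/0 := 0); only ever applied to nonzero values
-- (valencies, multiplicities, |Ω|) for the parameters in the lemma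
inv : ℚ → ℚ
inv (mkℚ +0 _ _) = 0ℚ
inv p@(mkℚ +[1+ _ ] _ _) = 1/ p
inv p@(mkℚ -[1+ _ ] _ _) = 1/ p

ℤ→ℚ : ℤ → ℚ
ℤ→ℚ z = z ÷ℤ 1

Σ5 : (Fin 5 → ℚ) → ℚ
Σ5 f = let open Rat using (_+_) in f zero + f (suc zero) + f (suc (suc zero)) + f (suc (suc (suc zero)))
       + f (suc (suc (suc (suc zero))))

-- The first eigenmatrix P (entry (i,ℓ) = eigenvalue of A_ℓ on col space of E_i)
-- of the scheme on Q⁻(2n-1,q) \ Π, exactly as given in the context.
eigP : ℕ → ℕ → Fin 5 → Fin 5 → ℤ
eigP q n i ℓ = row i ℓ
  where
  open Int using (_+_; _*_; _-_; -_)
  A B Q2 : ℤ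
  A  = + (q ^ (n ∸ 2))
  B  = + (q ^ (n ∸ 1)) + + 1
  Q2 = + q - + 2
  r : ℤ → ℤ → ℤ → ℤ → ℤ → Fin 5 → ℤ
  r a b c d e zero = a
  r a b c d e (suc zero) = b
  r a b c d e (suc (suc zero)) = c
  r a b c d e (suc (suc (suc zero))) = d
  r a b c d e (suc (suc (suc (suc zero)))) = e
  row : Fin 5 → Fin 5 → ℤ
  row zero = r (+ 1) ((A - + 1) * B) (A * Q2 * B) ((A - + 1) * B) (+ 1)
  row (suc zero) = r (+ 1) B (+ 0) (- B) (- + 1)
  row (suc (suc zero)) = r (+ 1) (A - + 1) (- (+ 2 * A)) (A - + 1) (+ 1)
  row (suc (suc (suc zero))) = r (+ 1) (- (A - + 1)) (+ 0) (A - + 1) (- + 1)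
  row (suc (suc (suc (suc zero)))) =
    r (+ 1) (- (A * Q2) - + 1) (+ 2 * A * Q2) (- (A * Q2) - + 1) (+ 1)

module Scheme (q n : ℕ) where

  open Rat using (_+_; _*_)

  P : Fin 5 → Fin 5 → ℚ
  P i ℓ = ℤ→ℚ (eigP q n i ℓ)

  k : Fin 5 → ℚ
  k ℓ = P zero ℓ

  v : ℚ
  v = Σ5 k

  -- multiplicities via the orthogonality relation Σ_ℓ P_iℓ² / k_ℓ = |Ω| / m_i
  m : Fin 5 → ℚ
  m i = v * inv (Σ5 λ ℓ → P i ℓ * P i ℓ * inv (k ℓ))

  -- second eigenmatrix Q = |Ω| P⁻¹, via Q_νi = m_i P_iν / k_ν
  Qm : Fin 5 → Fin 5 → ℚ
  Qm ν i = m i * P i ν * inv (k ν)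

  -- intersection numbers p_ij^h  (A_i A_j = Σ_h p_ij^h A_h)
  p : Fin 5 → Fin 5 → Fin 5 → ℚ
  p i j h = inv (v * k h) * Σ5 λ ν → m ν * P ν i * P ν j * P ν h

  -- Krein parameters q_ij^h  (E_i ∘ E_j = |Ω|⁻¹ Σ_h q_ij^h E_h)
  kr : Fin 5 → Fin 5 → Fin 5 → ℚ
  kr i j h = inv (v * m h) * Σ5 λ ν → k ν * Qm ν i * Qm ν j * Qm ν h

-- generic "polynomial ordering" condition on a 3-index parameter family,
-- with respect to the ordering σ (position t ↦ original index σ t)
PolyOrdered : (Fin 5 → Fin 5 → Fin 5 → ℚ) → Permutation′ 5 → Set
PolyOrdered c σ =
  (∀ i j h → (toℕ i ℕ.+ toℕ j < toℕ h ⊎ toℕ h < ∣ toℕ i - toℕ j ∣)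
           → c (σ ⟨$⟩ʳ i) (σ ⟨$⟩ʳ j) (σ ⟨$⟩ʳ h) ≡ 0ℚ)
  × (∀ i j h → toℕ h ≡ toℕ i ℕ.+ toℕ j
           → c (σ ⟨$⟩ʳ i) (σ ⟨$⟩ʳ j) (σ ⟨$⟩ʳ h) ≢ 0ℚ)

FixesZero : Permutation′ 5 → Set
FixesZero σ = σ ⟨$⟩ʳ zero ≡ zero

Metric : ℕ → ℕ → Permutation′ 5 → Set
Metric q n σ = PolyOrdered (Scheme.p q n) σ

Cometric : ℕ → ℕ → Permutation′ 5 → Set
Cometric q n σ = PolyOrdered (Scheme.kr q n) σ

{-# OPTIONS --safe #-}

-- Write x = q and a = q^(n-2).  Every entry of the eigenmatrix P is an integer
-- polynomial in x and a, and after clearing the (nonvanishing) valencies and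
-- multiplicities, each intersection number p_ij^h and each Krein parameter
-- q_ij^h becomes a nonzero rational multiple of an integer polynomial that is
-- symmetric in i, j, h.  For the few index triples that matter, these
-- polynomials either vanish identically or split into factors that are
-- positive whenever q ≥ 3 and q^(n-2) ≥ q; the single exception q_11^4 carries
-- the factor a - x and so vanishes exactly when n = 3.  Any (co)metric
-- ordering has to respect this vanishing pattern, and a finite check over the
-- 24 orderings that keep the trivial class first shows that the pattern of
-- the p_ij^h admits none of them, while the pattern of the q_ij^h admits only
-- the given ordering when n = 3 and none when n > 3.

module Submission where

open import Defs
open import Data.Bool using (true; false; if_then_else_)
open import Data.Nat as ℕ using (ℕ; zero; suc; _<_; _≤_; _<ᵇ_; z≤n; s≤s)
import Data.Nat.Properties as ℕ
open import Data.Integer as ℤ using (ℤ; +_; +0; +[1+_]; -[1+_])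
import Data.Integer.Properties as ℤ
open import Data.Integer.Tactic.RingSolver using (ring; solve-∀)
open import Tactic.RingSolver.NonReflective ring using (Expr; Κ; Ι; _⊕_; _⊗_; ⊝_; module Ops)
import Tactic.RingSolver as ℚ-Solver
open import Tactic.RingSolver.Core.AlmostCommutativeRing using (AlmostCommutativeRing; fromCommutativeRing)
open import Level using (0ℓ)
open import Data.Rational as ℚ using (ℚ; mkℚ; 0ℚ; 1ℚ; _+_; _*_)
import Data.Rational.Properties as ℚ
open import Data.Nat.Coprimality using (1-coprimeTo) renaming (sym to coprime-sym)
open import Data.Fin using (Fin; zero; suc; toℕ)
import Data.Fin.Properties as Fin
open import Data.Fin.Permutation using (Permutation′; _⟨$⟩ʳ_; id)
open import Data.List using (List; []; _∷_)
open import Data.List.Relation.Unary.All as All using (All; []; _∷_)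
open import Data.Vec using (Vec; []; _∷_)
open import Data.Maybe using (nothing)
open import Data.Product using (Σ; _×_; _,_)
import Data.Product.Properties as Product
open import Data.Sum using (_⊎_; inj₁; inj₂)
open import Data.Empty using (⊥-elim)
open import Function.Bundles using (_⇔_; mk⇔; Equivalence; Injection)
open import Function.Properties.Inverse using (↔⇒↣)
open import Relation.Nullary using (¬_; Dec)
open import Relation.Nullary.Decidable using (_×-dec_; _⊎-dec_; _→-dec_; ¬?; from-yes)
open import Relation.Unary using (Decidable)
open import Relation.Binary.PropositionalEquality

pattern 0F = zero
pattern 1F = suc zero
pattern 2F = suc (suc zero)
pattern 3F = suc (suc (suc zero))
pattern 4F = suc (suc (suc (suc zero)))

cases₅ : ∀ {ℓ} {P : Fin 5 → Set ℓ} → P 0F → P 1F → P 2F → P 3F → P 4F → ∀ i → P i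
cases₅ p₀ p₁ p₂ p₃ p₄ 0F = p₀
cases₅ p₀ p₁ p₂ p₃ p₄ 1F = p₁
cases₅ p₀ p₁ p₂ p₃ p₄ 2F = p₂
cases₅ p₀ p₁ p₂ p₃ p₄ 3F = p₃
cases₅ p₀ p₁ p₂ p₃ p₄ 4F = p₄

Triple : Set
Triple = Fin 5 × Fin 5 × Fin 5

_≟ᵗ_ : (s t : Triple) → Dec (s ≡ t)
_≟ᵗ_ = Product.≡-dec Fin._≟_ (Product.≡-dec Fin._≟_ Fin._≟_)

open import Data.List.Membership.DecPropositional _≟ᵗ_ using (_∈_; _∉_; _∈?_)

order₁₂ order₂₃ sort : Triple → Triple
order₁₂ (i , j , h) = if toℕ j <ᵇ toℕ i then (j , i , h) else (i , j , h)
order₂₃ (i , j , h) = if toℕ h <ᵇ toℕ j then (i , h , j) else (i , j , h)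
sort t = order₁₂ (order₂₃ (order₁₂ t))

module _ {A : Set} (f : Triple → A)
         (swap₁₂ : ∀ i j h → f (j , i , h) ≡ f (i , j , h))
         (swap₂₃ : ∀ i j h → f (i , h , j) ≡ f (i , j , h)) where

  private
    order₁₂-invariant : ∀ t → f (order₁₂ t) ≡ f t
    order₁₂-invariant (i , j , h) with toℕ j <ᵇ toℕ i
    ... | true  = swap₁₂ i j h
    ... | false = refl

    order₂₃-invariant : ∀ t → f (order₂₃ t) ≡ f t
    order₂₃-invariant (i , j , h) with toℕ h <ᵇ toℕ j
    ... | true  = swap₂₃ i j h
    ... | false = refl

  sort-invariant : ∀ t → f (sort t) ≡ f t
  sort-invariant t =
    trans (order₁₂-invariant _) (trans (order₂₃-invariant _) (order₁₂-invariant t))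

-- Integer polynomials in x and a

Poly : Set
Poly = Expr ℤ 2

⟦_⟧ : Poly → Vec ℤ 2 → ℤ
⟦_⟧ = Ops.⟦_⟧

x a : Poly
x = Ι 0F
a = Ι 1F

κ : ℕ → Poly
κ n = Κ (+ n)

infixl 6 _⊖_
_⊖_ : Poly → Poly → Poly
p ⊖ r = p ⊕ ⊝ r

Σ⁵ : (Fin 5 → Poly) → Poly
Σ⁵ f = f 0F ⊕ f 1F ⊕ f 2F ⊕ f 3F ⊕ f 4F

⟦Σ⁵⟧-cong : ∀ f g ρ → (∀ ν → ⟦ f ν ⟧ ρ ≡ ⟦ g ν ⟧ ρ) → ⟦ Σ⁵ f ⟧ ρ ≡ ⟦ Σ⁵ g ⟧ ρ
⟦Σ⁵⟧-cong f g ρ e =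
  cong₂ ℤ._+_ (cong₂ ℤ._+_ (cong₂ ℤ._+_ (cong₂ ℤ._+_ (e 0F) (e 1F)) (e 2F)) (e 3F)) (e 4F)

-- Proved by refl: the ring solver's normal form of p is the zero polynomial.
NormalisesTo0 : Poly → Set
NormalisesTo0 p = ∀ ρ → Ops.⟦ p ⇓⟧ ρ ≡ + 0

normalises-to-0⇒vanishes : ∀ p → NormalisesTo0 p → ∀ ρ → ⟦ p ⟧ ρ ≡ + 0
normalises-to-0⇒vanishes p nf ρ = trans (sym (Ops.correct p ρ)) (nf ρ)

normalises-to-0⇒≗ : ∀ p r → NormalisesTo0 (p ⊖ r) → ⟦ p ⟧ ≗ ⟦ r ⟧
normalises-to-0⇒≗ p r nf ρ = ℤ.i-j≡0⇒i≡j _ _ (normalises-to-0⇒vanishes (p ⊖ r) nf ρ)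

data Factor : Set where
  [2] [x] [a] [x-1] [x-2] [x+1] [a-1] [xa+1] [xa-1] : Factor
  [a²-ax+a-2] [ax-2a+1] [x²a+x+2] [x²a+2x+1] : Factor

⌜_⌝ : Factor → Poly
⌜ [2] ⌝          = κ 2
⌜ [x] ⌝          = x
⌜ [a] ⌝          = a
⌜ [x-1] ⌝        = x ⊖ κ 1
⌜ [x-2] ⌝        = x ⊖ κ 2
⌜ [x+1] ⌝        = x ⊕ κ 1
⌜ [a-1] ⌝        = a ⊖ κ 1
⌜ [xa+1] ⌝       = x ⊗ a ⊕ κ 1
⌜ [xa-1] ⌝       = x ⊗ a ⊖ κ 1
⌜ [a²-ax+a-2] ⌝  = a ⊗ (a ⊖ x) ⊕ (a ⊖ κ 2)
⌜ [ax-2a+1] ⌝    = a ⊗ (x ⊖ κ 2) ⊕ κ 1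
⌜ [x²a+x+2] ⌝    = x ⊗ (x ⊗ a ⊕ κ 1) ⊕ κ 2
⌜ [x²a+2x+1] ⌝   = x ⊗ (x ⊗ a ⊕ κ 2) ⊕ κ 1

Π : List Factor → Poly
Π []       = κ 1
Π (f ∷ fs) = ⌜ f ⌝ ⊗ Π fs

Factorisation : Poly → Set
Factorisation p = Σ (List Factor) λ fs → NormalisesTo0 (p ⊖ Π fs)

Admissible : Vec ℤ 2 → Set
Admissible ρ = ∀ f → ⟦ ⌜ f ⌝ ⟧ ρ ≢ + 0

*-≢0ℤ : ∀ {i j} → i ≢ + 0 → j ≢ + 0 → i ℤ.* j ≢ + 0
*-≢0ℤ {i} i≢0 j≢0 ij≡0 with ℤ.i*j≡0⇒i≡0∨j≡0 i ij≡0
... | inj₁ i≡0 = i≢0 i≡0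
... | inj₂ j≡0 = j≢0 j≡0

Π-nonzero : ∀ {ρ} → Admissible ρ → ∀ fs → ⟦ Π fs ⟧ ρ ≢ + 0
Π-nonzero adm []       = λ ()
Π-nonzero adm (f ∷ fs) = *-≢0ℤ (adm f) (Π-nonzero adm fs)

factorisation-nonzero : ∀ {ρ} → Admissible ρ → ∀ p → Factorisation p → ⟦ p ⟧ ρ ≢ + 0
factorisation-nonzero {ρ} adm p (fs , nf) p≡0 =
  Π-nonzero adm fs (trans (sym (normalises-to-0⇒≗ p (Π fs) nf ρ)) p≡0)

point : ℕ → ℕ → Vec ℤ 2
point s u = + (3 ℕ.+ s) ∷ + (3 ℕ.+ s ℕ.+ u) ∷ []

a-x-at-point : ∀ s u → ⟦ a ⊖ x ⟧ (point s u) ≡ + u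
a-x-at-point s u = cancel (+ (3 ℕ.+ s)) (+ u)
  where
  cancel : ∀ i j → i ℤ.+ j ℤ.- i ≡ j
  cancel = solve-∀

-- At x = 3 + s, a = 3 + s + u every factor except a² - ax + a - 2 evaluates to a
-- successor numeral, so its nonvanishing is decided by computation.
admissible-point : ∀ s u → Admissible (point s u)
admissible-point s u [2]          = λ ()
admissible-point s u [x]          = λ ()
admissible-point s u [a]          = λ ()
admissible-point s u [x-1]        = λ ()
admissible-point s u [x-2]        = λ ()
admissible-point s u [x+1]        = λ ()
admissible-point s u [a-1]        = λ ()
admissible-point s u [xa+1]       = λ ()
admissible-point s u [xa-1]       = λ ()
admissible-point s u [ax-2a+1]    = λ ()
admissible-point s u [x²a+x+2]    = λ ()
admissible-point s u [x²a+2x+1]   = λ ()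
admissible-point s u [a²-ax+a-2] eq with trans (sym value) eq
  where
  A : ℕ
  A = 3 ℕ.+ s ℕ.+ u
  value : ⟦ ⌜ [a²-ax+a-2] ⌝ ⟧ (point s u) ≡ + suc (A ℕ.* u ℕ.+ (s ℕ.+ u))
  value = begin
    + A ℤ.* ⟦ a ⊖ x ⟧ (point s u) ℤ.+ + suc (s ℕ.+ u)
      ≡⟨ cong (λ d → + A ℤ.* d ℤ.+ + suc (s ℕ.+ u)) (a-x-at-point s u) ⟩
    + A ℤ.* + u ℤ.+ + suc (s ℕ.+ u)
      ≡⟨ cong (ℤ._+ + suc (s ℕ.+ u)) (sym (ℤ.pos-* A u)) ⟩
    + (A ℕ.* u ℕ.+ suc (s ℕ.+ u))
      ≡⟨ cong +_ (ℕ.+-suc (A ℕ.* u) (s ℕ.+ u)) ⟩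
    + suc (A ℕ.* u ℕ.+ (s ℕ.+ u))
      ∎
    where open ≡-Reasoning
... | ()

-- B stands for q^(n-1) + 1; keeping it a parameter lets the rows agree with eigP
-- on the nose.
eigenmatrix : Poly → Fin 5 → Fin 5 → Poly
eigenmatrix B 0F = cases₅ (κ 1) ((a ⊖ κ 1) ⊗ B) (a ⊗ (x ⊖ κ 2) ⊗ B) ((a ⊖ κ 1) ⊗ B) (κ 1)
eigenmatrix B 1F = cases₅ (κ 1) B (κ 0) (⊝ B) (⊝ κ 1)
eigenmatrix B 2F = cases₅ (κ 1) (a ⊖ κ 1) (⊝ (κ 2 ⊗ a)) (a ⊖ κ 1) (κ 1)
eigenmatrix B 3F = cases₅ (κ 1) (⊝ (a ⊖ κ 1)) (κ 0) (a ⊖ κ 1) (⊝ κ 1)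
eigenmatrix B 4F = cases₅ (κ 1) (⊝ (a ⊗ (x ⊖ κ 2)) ⊖ κ 1) (κ 2 ⊗ a ⊗ (x ⊖ κ 2))
                          (⊝ (a ⊗ (x ⊖ κ 2)) ⊖ κ 1) (κ 1)

eigenmatrix-at-constant : ∀ B ρ i ℓ →
  ⟦ eigenmatrix B i ℓ ⟧ ρ ≡ ⟦ eigenmatrix (Κ (⟦ B ⟧ ρ)) i ℓ ⟧ ρ
eigenmatrix-at-constant B ρ =
  cases₅ (cases₅ refl refl refl refl refl) (cases₅ refl refl refl refl refl)
         (cases₅ refl refl refl refl refl) (cases₅ refl refl refl refl refl)
         (cases₅ refl refl refl refl refl)

E : Fin 5 → Fin 5 → Poly
E = eigenmatrix (x ⊗ a ⊕ κ 1)

K₁ K₂ : Poly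
K₁ = E 0F 1F
K₂ = E 0F 2F

valency-factorises : ∀ ν → Factorisation (E 0F ν)
valency-factorises = cases₅
  ([] , λ _ → refl)
  ([a-1] ∷ [xa+1] ∷ [] , λ _ → refl)
  ([a] ∷ [x-2] ∷ [xa+1] ∷ [] , λ _ → refl)
  ([a-1] ∷ [xa+1] ∷ [] , λ _ → refl)
  ([] , λ _ → refl)

-- K₁K₂ divided by the valency k_ν.
cofactor : Fin 5 → Poly
cofactor = cases₅ (K₁ ⊗ K₂) K₂ K₁ K₂ (K₁ ⊗ K₂)

cofactor-identity : ∀ ν → NormalisesTo0 (E 0F ν ⊗ cofactor ν ⊖ K₁ ⊗ K₂)
cofactor-identity = cases₅ (λ _ → refl) (λ _ → refl) (λ _ → refl) (λ _ → refl) (λ _ → refl)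

order-factors : List Factor
order-factors = [x] ∷ [a] ∷ [xa-1] ∷ []

order : Poly
order = Π order-factors

order-identity : NormalisesTo0 (Σ⁵ (E 0F) ⊖ order)
order-identity _ = refl

-- The multiplicity m_ν is M ν / D.
D-factors : List Factor
D-factors = [2] ∷ [x+1] ∷ [x-1] ∷ []

M-factors : Fin 5 → List Factor
M-factors = cases₅ D-factors
  ([x] ∷ [a-1] ∷ [xa-1] ∷ [x-1] ∷ []) ([x-2] ∷ [xa-1] ∷ [xa+1] ∷ [x+1] ∷ [])
  ([x] ∷ [xa-1] ∷ [xa+1] ∷ [x-1] ∷ []) ([x] ∷ [a-1] ∷ [xa+1] ∷ [x+1] ∷ [])

D : Poly
D = Π D-factors

M : Fin 5 → Poly
M ν = Π (M-factors ν)

-- K₁K₂ times Σ_ℓ P_iℓ² / k_ℓ, the quantity inverted in the definition of m_i.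
norm : Fin 5 → Poly
norm i = Σ⁵ λ ℓ → E i ℓ ⊗ E i ℓ ⊗ cofactor ℓ

multiplicity-identity : ∀ ν → NormalisesTo0 (norm ν ⊗ M ν ⊖ order ⊗ (K₁ ⊗ K₂) ⊗ D)
multiplicity-identity =
  cases₅ (λ _ → refl) (λ _ → refl) (λ _ → refl) (λ _ → refl) (λ _ → refl)

triple-term : (Fin 5 → Poly) → (Fin 5 → Fin 5 → Poly) → Triple → Fin 5 → Poly
triple-term w u (i , j , h) ν = w ν ⊗ u i ν ⊗ u j ν ⊗ u h ν

triple-sum : (Fin 5 → Poly) → (Fin 5 → Fin 5 → Poly) → Triple → Poly
triple-sum w u t = Σ⁵ (triple-term w u t)

triple-sum-sort : ∀ w u ρ t → ⟦ triple-sum w u (sort t) ⟧ ρ ≡ ⟦ triple-sum w u t ⟧ ρ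
triple-sum-sort w u ρ = sort-invariant (λ t → ⟦ triple-sum w u t ⟧ ρ)
  (λ i j h → ⟦Σ⁵⟧-cong (term (j , i , h)) (term (i , j , h)) ρ λ ν →
     exchange₁₂ (⟦ w ν ⟧ ρ) (⟦ u j ν ⟧ ρ) (⟦ u i ν ⟧ ρ) (⟦ u h ν ⟧ ρ))
  (λ i j h → ⟦Σ⁵⟧-cong (term (i , h , j)) (term (i , j , h)) ρ λ ν →
     exchange₂₃ (⟦ w ν ⟧ ρ) (⟦ u i ν ⟧ ρ) (⟦ u h ν ⟧ ρ) (⟦ u j ν ⟧ ρ))
  where
  term : Triple → Fin 5 → Poly
  term = triple-term w u
  exchange₁₂ : ∀ w p r s → w ℤ.* p ℤ.* r ℤ.* s ≡ w ℤ.* r ℤ.* p ℤ.* s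
  exchange₁₂ = solve-∀
  exchange₂₃ : ∀ w p r s → w ℤ.* p ℤ.* r ℤ.* s ≡ w ℤ.* p ℤ.* s ℤ.* r
  exchange₂₃ = solve-∀

-- krein (i , j , h) = |Ω| (K₁K₂)² q_ij^h / (m_i m_j) and
-- intersection (i , j , h) = |Ω| D k_h p_ij^h.
krein intersection : Triple → Poly
krein = triple-sum (λ ν → cofactor ν ⊗ cofactor ν) E
intersection = triple-sum M λ i ν → E ν i

-- Only the multisets the argument needs; (1,1,4) is left out because whether it
-- vanishes depends on n.
krein-zeros krein-nonzeros : List Triple
krein-zeros = (0F , 0F , 1F) ∷ (0F , 0F , 2F) ∷ (0F , 0F , 3F) ∷ (0F , 0F , 4F) ∷ (0F , 1F , 2F)
            ∷ (0F , 1F , 3F) ∷ (0F , 1F , 4F) ∷ (0F , 2F , 3F) ∷ (0F , 2F , 4F) ∷ (0F , 3F , 4F)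
            ∷ (1F , 1F , 3F) ∷ (1F , 2F , 4F) ∷ (2F , 3F , 4F) ∷ []
krein-nonzeros = (0F , 0F , 0F) ∷ (0F , 1F , 1F) ∷ (0F , 2F , 2F) ∷ (0F , 3F , 3F) ∷ (0F , 4F , 4F)
               ∷ (1F , 1F , 2F) ∷ (1F , 2F , 3F) ∷ (1F , 3F , 4F) ∷ (2F , 2F , 4F) ∷ (2F , 3F , 3F)
               ∷ (3F , 3F , 4F) ∷ []

krein-vanishes : All (λ t → NormalisesTo0 (krein t)) krein-zeros
krein-vanishes =
    (λ _ → refl) ∷ (λ _ → refl) ∷ (λ _ → refl) ∷ (λ _ → refl) ∷ (λ _ → refl)
  ∷ (λ _ → refl) ∷ (λ _ → refl) ∷ (λ _ → refl) ∷ (λ _ → refl) ∷ (λ _ → refl)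
  ∷ (λ _ → refl) ∷ (λ _ → refl) ∷ (λ _ → refl) ∷ []

krein-factorises : All (λ t → Factorisation (krein t)) krein-nonzeros
krein-factorises =
    ([x] ∷ [a] ∷ [a] ∷ [a] ∷ [x-2] ∷ [x-2] ∷ [a-1] ∷
       [a-1] ∷ [xa+1] ∷ [xa+1] ∷ [xa+1] ∷ [xa+1] ∷ [xa-1] ∷ [] , λ _ → refl)
  ∷ ([2] ∷ [a] ∷ [a] ∷ [a] ∷ [x-2] ∷ [x-2] ∷ [x+1] ∷
       [a-1] ∷ [xa+1] ∷ [xa+1] ∷ [xa+1] ∷ [xa+1] ∷ [] , λ _ → refl)
  ∷ ([2] ∷ [x] ∷ [a] ∷ [a] ∷ [a] ∷ [x-1] ∷ [x-2] ∷
       [a-1] ∷ [a-1] ∷ [xa+1] ∷ [xa+1] ∷ [xa+1] ∷ [] , λ _ → refl)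
  ∷ ([2] ∷ [a] ∷ [a] ∷ [a] ∷ [x-2] ∷ [x-2] ∷ [x+1] ∷
       [a-1] ∷ [a-1] ∷ [xa+1] ∷ [xa+1] ∷ [xa+1] ∷ [] , λ _ → refl)
  ∷ ([2] ∷ [a] ∷ [a] ∷ [a] ∷ [x-1] ∷ [x-2] ∷ [x-2] ∷
       [a-1] ∷ [xa+1] ∷ [xa+1] ∷ [xa+1] ∷ [xa-1] ∷ [] , λ _ → refl)
  ∷ ([2] ∷ [a] ∷ [a] ∷ [a] ∷ [x-2] ∷ [x-2] ∷
       [a-1] ∷ [xa+1] ∷ [xa+1] ∷ [xa+1] ∷ [xa+1] ∷ [] , λ _ → refl)
  ∷ ([2] ∷ [x] ∷ [a] ∷ [a] ∷ [a] ∷ [x-2] ∷ [x-2] ∷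
       [a-1] ∷ [a-1] ∷ [xa+1] ∷ [xa+1] ∷ [xa+1] ∷ [] , λ _ → refl)
  ∷ ([2] ∷ [a] ∷ [a] ∷ [a] ∷ [x-2] ∷ [x-2] ∷
       [a-1] ∷ [xa+1] ∷ [xa+1] ∷ [xa+1] ∷ [xa-1] ∷ [] , λ _ → refl)
  ∷ ([2] ∷ [x] ∷ [x] ∷ [a] ∷ [a] ∷ [a] ∷ [x-2] ∷
       [a-1] ∷ [a-1] ∷ [xa+1] ∷ [xa+1] ∷ [ax-2a+1] ∷ [] , λ _ → refl)
  ∷ ([2] ∷ [a] ∷ [a] ∷ [a] ∷ [x-2] ∷ [x-2] ∷
       [a-1] ∷ [a-1] ∷ [xa+1] ∷ [xa+1] ∷ [x²a+2x+1] ∷ [] , λ _ → refl)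
  ∷ ([2] ∷ [a] ∷ [a] ∷ [a] ∷ [x-2] ∷ [x-2] ∷
       [a-1] ∷ [a-1] ∷ [xa+1] ∷ [xa+1] ∷ [x²a+x+2] ∷ [] , λ _ → refl)
  ∷ []

krein-114-factors : List Factor
krein-114-factors =
  [2] ∷ [a] ∷ [a] ∷ [a] ∷ [x-2] ∷ [x-2] ∷ [xa+1] ∷ [xa+1] ∷ [xa+1] ∷ [xa+1] ∷ []

krein-114 : NormalisesTo0 (krein (1F , 1F , 4F) ⊖ (a ⊖ x) ⊗ Π krein-114-factors)
krein-114 _ = refl

intersection-zeros intersection-nonzeros : List Triple
intersection-zeros    = (1F , 2F , 4F) ∷ (2F , 3F , 4F) ∷ []
intersection-nonzeros = (1F , 1F , 3F) ∷ (1F , 3F , 3F) ∷ []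

intersection-vanishes : All (λ t → NormalisesTo0 (intersection t)) intersection-zeros
intersection-vanishes = (λ _ → refl) ∷ (λ _ → refl) ∷ []

intersection-factorises : All (λ t → Factorisation (intersection t)) intersection-nonzeros
intersection-factorises =
    ([2] ∷ [x] ∷ [a] ∷ [x-1] ∷ [x+1] ∷
       [a-1] ∷ [xa+1] ∷ [xa-1] ∷ [a²-ax+a-2] ∷ [] , λ _ → refl)
  ∷ ([2] ∷ [x] ∷ [a] ∷ [a] ∷ [a] ∷
       [x-1] ∷ [x+1] ∷ [a-1] ∷ [xa+1] ∷ [xa-1] ∷ [] , λ _ → refl)
  ∷ []

-- fromℤ z is z / 1 without normalisation, on which ℚ's operations compute.
private
  fromℤ : ℤ → ℚ
  fromℤ z = mkℚ z 0 (coprime-sym (1-coprimeTo _))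

  ℤ→ℚ-fromℤ : ∀ z → ℤ→ℚ z ≡ fromℤ z
  ℤ→ℚ-fromℤ z = ℚ.↥p/↧p≡p (fromℤ z)

ℤ→ℚ-* : ∀ i j → ℤ→ℚ (i ℤ.* j) ≡ ℤ→ℚ i * ℤ→ℚ j
ℤ→ℚ-* i j = sym (cong₂ _*_ (ℤ→ℚ-fromℤ i) (ℤ→ℚ-fromℤ j))

ℤ→ℚ-+ : ∀ i j → ℤ→ℚ (i ℤ.+ j) ≡ ℤ→ℚ i + ℤ→ℚ j
ℤ→ℚ-+ i j =
  trans (cong (ℚ._/ 1) (cong₂ ℤ._+_ (sym (ℤ.*-identityʳ i)) (sym (ℤ.*-identityʳ j))))
        (sym (cong₂ _+_ (ℤ→ℚ-fromℤ i) (ℤ→ℚ-fromℤ j)))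

ℤ→ℚ-≡0 : ∀ {z} → ℤ→ℚ z ≡ 0ℚ → z ≡ + 0
ℤ→ℚ-≡0 {z} e = cong ℚ.↥_ (trans (sym (ℤ→ℚ-fromℤ z)) e)

ℤ→ℚ-≢0 : ∀ {z} → z ≢ + 0 → ℤ→ℚ z ≢ 0ℚ
ℤ→ℚ-≢0 z≢0 e = z≢0 (ℤ→ℚ-≡0 e)

ringℚ : AlmostCommutativeRing 0ℓ 0ℓ
ringℚ = fromCommutativeRing ℚ.+-*-commutativeRing (λ _ → nothing)

*-inv : ∀ p → p ≢ 0ℚ → p * inv p ≡ 1ℚ
*-inv p@(mkℚ +0 _ _)       p≢0 = ⊥-elim (p≢0 (ℚ.↥p≡0⇒p≡0 p refl))
*-inv p@(mkℚ +[1+ _ ] _ _) _   = ℚ.*-inverseʳ p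
*-inv p@(mkℚ -[1+ _ ] _ _) _   = ℚ.*-inverseʳ p

*-cancel-≡0 : ∀ {p r} → p ≢ 0ℚ → p * r ≡ 0ℚ → r ≡ 0ℚ
*-cancel-≡0 {p} {r} p≢0 pr≡0 = begin
  r                    ≡⟨ sym (ℚ.*-identityˡ r) ⟩
  1ℚ * r             ≡⟨ cong (_* r) (sym (*-inv p p≢0)) ⟩
  p * inv p * r    ≡⟨ rearrange p (inv p) r ⟩
  inv p * (p * r)  ≡⟨ cong (inv p *_) pr≡0 ⟩
  inv p * 0ℚ         ≡⟨ ℚ.*-zeroʳ (inv p) ⟩
  0ℚ                   ∎
  where
  open ≡-Reasoning
  rearrange : ∀ p p⁻¹ r → p * p⁻¹ * r ≡ p⁻¹ * (p * r)
  rearrange = ℚ-Solver.solve-∀ ringℚ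

*-≢0 : ∀ {p r} → p ≢ 0ℚ → r ≢ 0ℚ → p * r ≢ 0ℚ
*-≢0 p≢0 r≢0 pr≡0 = r≢0 (*-cancel-≡0 p≢0 pr≡0)

inv-≢0 : ∀ {p} → p ≢ 0ℚ → inv p ≢ 0ℚ
inv-≢0 {p} p≢0 inv≡0 =
  ℚ.1≢0 (trans (sym (*-inv p p≢0)) (trans (cong (p *_) inv≡0) (ℚ.*-zeroʳ p)))

inv-from-product : ∀ {p r s} → p ≢ 0ℚ → s ≢ 0ℚ → p * r ≡ s → inv p ≡ r * inv s
inv-from-product {p} {r} {s} p≢0 s≢0 pr≡s = begin
  inv p                              ≡⟨ sym (ℚ.*-identityʳ (inv p)) ⟩
  inv p * 1ℚ                       ≡⟨ cong (inv p *_) (sym (*-inv s s≢0)) ⟩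
  inv p * (s * inv s)            ≡⟨ cong (λ z → inv p * (z * inv s)) (sym pr≡s) ⟩
  inv p * (p * r * inv s)      ≡⟨ rearrange p (inv p) r (inv s) ⟩
  p * inv p * (r * inv s)      ≡⟨ cong (_* (r * inv s)) (*-inv p p≢0) ⟩
  1ℚ * (r * inv s)               ≡⟨ ℚ.*-identityˡ _ ⟩
  r * inv s                        ∎
  where
  open ≡-Reasoning
  rearrange : ∀ p p⁻¹ r s⁻¹ → p⁻¹ * (p * r * s⁻¹) ≡ p * p⁻¹ * (r * s⁻¹)
  rearrange = ℚ-Solver.solve-∀ ringℚ

cross-division : ∀ {s r v d} → v ≢ 0ℚ → d ≢ 0ℚ → s * r ≡ v * d → v * inv s ≡ r * inv d
cross-division {s} {r} {v} {d} v≢0 d≢0 sr≡vd = begin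
  v * inv s                            ≡⟨ sym (ℚ.*-identityʳ _) ⟩
  v * inv s * 1ℚ                     ≡⟨ cong (v * inv s *_) (sym (*-inv d d≢0)) ⟩
  v * inv s * (d * inv d)          ≡⟨ rearrange₁ v (inv s) d (inv d) ⟩
  v * d * inv s * inv d            ≡⟨ cong (λ z → z * inv s * inv d) (sym sr≡vd) ⟩
  s * r * inv s * inv d            ≡⟨ rearrange₂ s r (inv s) (inv d) ⟩
  s * inv s * (r * inv d)          ≡⟨ cong (_* (r * inv d)) (*-inv s s≢0) ⟩
  1ℚ * (r * inv d)                   ≡⟨ ℚ.*-identityˡ _ ⟩
  r * inv d                            ∎
  where
  open ≡-Reasoning
  s≢0 : s ≢ 0ℚ
  s≢0 s≡0 = *-≢0 v≢0 d≢0 (trans (sym sr≡vd) (trans (cong (_* r) s≡0) (ℚ.*-zeroˡ r)))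
  rearrange₁ : ∀ v s⁻¹ d d⁻¹ → v * s⁻¹ * (d * d⁻¹) ≡ v * d * s⁻¹ * d⁻¹
  rearrange₁ = ℚ-Solver.solve-∀ ringℚ
  rearrange₂ : ∀ s r s⁻¹ d⁻¹ → s * r * s⁻¹ * d⁻¹ ≡ s * s⁻¹ * (r * d⁻¹)
  rearrange₂ = ℚ-Solver.solve-∀ ringℚ

scaled-vanishing : ∀ {y c z} → c ≢ 0ℚ → y ≡ c * ℤ→ℚ z → (y ≡ 0ℚ ⇔ z ≡ + 0)
scaled-vanishing {c = c} c≢0 y≡cz =
  mk⇔ (λ y≡0 → ℤ→ℚ-≡0 (*-cancel-≡0 c≢0 (trans (sym y≡cz) y≡0)))
      (λ { refl → trans y≡cz (ℚ.*-zeroʳ c) })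

Σ5-cong : ∀ {f g} → (∀ ν → f ν ≡ g ν) → Σ5 f ≡ Σ5 g
Σ5-cong e = cong₂ _+_ (cong₂ _+_ (cong₂ _+_ (cong₂ _+_ (e 0F) (e 1F)) (e 2F)) (e 3F)) (e 4F)

Violates Tight : Fin 5 → Fin 5 → Fin 5 → Set
Violates i j h = toℕ i ℕ.+ toℕ j < toℕ h ⊎ toℕ h < ℕ.∣ toℕ i - toℕ j ∣
Tight i j h = toℕ h ≡ toℕ i ℕ.+ toℕ j

violates? : ∀ i j h → Dec (Violates i j h)
violates? i j h =
  (toℕ i ℕ.+ toℕ j ℕ.<? toℕ h) ⊎-dec (toℕ h ℕ.<? ℕ.∣ toℕ i - toℕ j ∣)

tight? : ∀ i j h → Dec (Tight i j h)
tight? i j h = toℕ h ℕ.≟ toℕ i ℕ.+ toℕ j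

-- The lists hold index multisets, each as its sorted triple.
Realises : (Fin 5 → Fin 5 → Fin 5 → ℚ) → List Triple → List Triple → Set
Realises c zeros nonzeros = (∀ i j h → sort (i , j , h) ∈ zeros → c i j h ≡ 0ℚ)
                          × (∀ i j h → sort (i , j , h) ∈ nonzeros → c i j h ≢ 0ℚ)

realises : ∀ {c} (V : Triple → ℤ) {zeros nonzeros} →
           (∀ i j h → c i j h ≡ 0ℚ ⇔ V (sort (i , j , h)) ≡ + 0) →
           All (λ t → V t ≡ + 0) zeros → All (λ t → V t ≢ + 0) nonzeros →
           Realises c zeros nonzeros
realises V vanishing V≡0 V≢0 =
  (λ i j h ∈zeros → Equivalence.from (vanishing i j h) (All.lookup V≡0 ∈zeros)) ,
  (λ i j h ∈nonzeros c≡0 → All.lookup V≢0 ∈nonzeros (Equivalence.to (vanishing i j h) c≡0))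

Compatible : List Triple → List Triple → (Fin 5 → Fin 5) → Set
Compatible zeros nonzeros f = ∀ i j h → (Violates i j h → sort (f i , f j , f h) ∉ nonzeros)
                                      × (Tight i j h → sort (f i , f j , f h) ∉ zeros)

compatible? : ∀ zeros nonzeros → Decidable (Compatible zeros nonzeros)
compatible? zeros nonzeros f = Fin.all? λ i → Fin.all? λ j → Fin.all? λ h →
  (violates? i j h →-dec ¬? (sort (f i , f j , f h) ∈? nonzeros)) ×-dec
  (tight? i j h →-dec ¬? (sort (f i , f j , f h) ∈? zeros))

compatible-cong : ∀ {zeros nonzeros f g} → (∀ i → f i ≡ g i) →
                  Compatible zeros nonzeros f → Compatible zeros nonzeros g
compatible-cong f≗g compatible i j h rewrite sym (f≗g i) | sym (f≗g j) | sym (f≗g h) =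
  compatible i j h

ordered⇒compatible : ∀ {c zeros nonzeros σ} → Realises c zeros nonzeros →
                     PolyOrdered c σ → Compatible zeros nonzeros (σ ⟨$⟩ʳ_)
ordered⇒compatible (vanish , nonvanish) (violated , tight) i j h =
  (λ v ∈nonzeros → nonvanish _ _ _ ∈nonzeros (violated i j h v)) ,
  (λ τ ∈zeros → tight i j h τ (vanish _ _ _ ∈zeros))

Injective : (Fin 5 → Fin 5) → Set
Injective f = ∀ i j → f i ≡ f j → i ≡ j

injective? : Decidable Injective
injective? f = Fin.all? λ i → Fin.all? λ j → (f i Fin.≟ f j) →-dec (i Fin.≟ j)

ordering : Fin 5 → Fin 5 → Fin 5 → Fin 5 → Fin 5 → Fin 5
ordering b₁ b₂ b₃ b₄ = cases₅ 0F b₁ b₂ b₃ b₄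

NoCompatibleOrdering OnlyIdentityCompatible : List Triple → List Triple → Set
NoCompatibleOrdering zeros nonzeros = ∀ b₁ b₂ b₃ b₄ →
  Injective (ordering b₁ b₂ b₃ b₄) → ¬ Compatible zeros nonzeros (ordering b₁ b₂ b₃ b₄)
OnlyIdentityCompatible zeros nonzeros = ∀ b₁ b₂ b₃ b₄ →
  Injective (ordering b₁ b₂ b₃ b₄) → Compatible zeros nonzeros (ordering b₁ b₂ b₃ b₄) →
  ∀ i → ordering b₁ b₂ b₃ b₄ i ≡ i

no-compatible-ordering? : ∀ zeros nonzeros → Dec (NoCompatibleOrdering zeros nonzeros)
no-compatible-ordering? zeros nonzeros =
  Fin.all? λ b₁ → Fin.all? λ b₂ → Fin.all? λ b₃ → Fin.all? λ b₄ →
  let f = ordering b₁ b₂ b₃ b₄ in injective? f →-dec ¬? (compatible? zeros nonzeros f)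

only-identity-compatible? : ∀ zeros nonzeros → Dec (OnlyIdentityCompatible zeros nonzeros)
only-identity-compatible? zeros nonzeros =
  Fin.all? λ b₁ → Fin.all? λ b₂ → Fin.all? λ b₃ → Fin.all? λ b₄ →
  let f = ordering b₁ b₂ b₃ b₄ in
  injective? f →-dec (compatible? zeros nonzeros f →-dec Fin.all? λ i → f i Fin.≟ i)

SupportsIdentity : List Triple → List Triple → Set
SupportsIdentity zeros nonzeros = (∀ i j h → Violates i j h → sort (i , j , h) ∈ zeros)
                                × (∀ i j h → Tight i j h → sort (i , j , h) ∈ nonzeros)

supports-identity? : ∀ zeros nonzeros → Dec (SupportsIdentity zeros nonzeros)
supports-identity? zeros nonzeros =
        (Fin.all? λ i → Fin.all? λ j → Fin.all? λ h →
           violates? i j h →-dec (sort (i , j , h) ∈? zeros))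
  ×-dec (Fin.all? λ i → Fin.all? λ j → Fin.all? λ h →
           tight? i j h →-dec (sort (i , j , h) ∈? nonzeros))

module _ (σ : Permutation′ 5) (σ0 : FixesZero σ) where

  private
    b : Fin 5 → Fin 5
    b i = σ ⟨$⟩ʳ i

    σ≗ordering : ∀ i → σ ⟨$⟩ʳ i ≡ ordering (b 1F) (b 2F) (b 3F) (b 4F) i
    σ≗ordering = cases₅ σ0 refl refl refl refl

    ordering-injective : Injective (ordering (b 1F) (b 2F) (b 3F) (b 4F))
    ordering-injective i j e =
      Injection.injective (↔⇒↣ σ) (trans (σ≗ordering i) (trans e (sym (σ≗ordering j))))

  no-ordering : ∀ {c zeros nonzeros} → Realises c zeros nonzeros →
                NoCompatibleOrdering zeros nonzeros → ¬ PolyOrdered c σ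
  no-ordering realised none ordered = none _ _ _ _ ordering-injective
    (compatible-cong σ≗ordering (ordered⇒compatible {σ = σ} realised ordered))

  only-identity : ∀ {c zeros nonzeros} → Realises c zeros nonzeros →
                  OnlyIdentityCompatible zeros nonzeros → PolyOrdered c σ →
                  ∀ i → σ ⟨$⟩ʳ i ≡ i
  only-identity realised only ordered i = trans (σ≗ordering i) (only _ _ _ _ ordering-injective
    (compatible-cong σ≗ordering (ordered⇒compatible {σ = σ} realised ordered)) i)

identity-ordered : ∀ {c zeros nonzeros} → Realises c zeros nonzeros →
                   SupportsIdentity zeros nonzeros → PolyOrdered c id
identity-ordered (vanish , nonvanish) (violated∈ , tight∈) =
  (λ i j h v → vanish i j h (violated∈ i j h v)) , (λ i j h τ → nonvanish i j h (tight∈ i j h τ))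

-- The scheme at x = q, a = q^m, n = m + 2

coordinates : ℕ → ℕ → Vec ℤ 2
coordinates q m = + q ∷ + (q ℕ.^ m) ∷ []

eigP-is-eigenmatrix : ∀ q m i ℓ →
  eigP q (2 ℕ.+ m) i ℓ ≡ ⟦ eigenmatrix (Κ (+ (q ℕ.^ suc m) ℤ.+ + 1)) i ℓ ⟧ (coordinates q m)
eigP-is-eigenmatrix q m =
  cases₅ (cases₅ refl refl refl refl refl) (cases₅ refl refl refl refl refl)
         (cases₅ refl refl refl refl refl) (cases₅ refl refl refl refl refl)
         (cases₅ refl refl refl refl refl)

module SchemeAt (q m : ℕ) (admissible : Admissible (coordinates q m)) where

  private
    module S = Scheme q (2 ℕ.+ m)

    ρ : Vec ℤ 2
    ρ = coordinates q m

    ⟦_⟧ℚ : Poly → ℚ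
    ⟦ p ⟧ℚ = ℤ→ℚ (⟦ p ⟧ ρ)

    ⟦⟧ℚ-⊗ : ∀ p r → ⟦ p ⊗ r ⟧ℚ ≡ ⟦ p ⟧ℚ * ⟦ r ⟧ℚ
    ⟦⟧ℚ-⊗ p r = ℤ→ℚ-* (⟦ p ⟧ ρ) (⟦ r ⟧ ρ)

    ⟦⟧ℚ-⊗₃ : ∀ p r s → ⟦ p ⊗ r ⊗ s ⟧ℚ ≡ ⟦ p ⟧ℚ * ⟦ r ⟧ℚ * ⟦ s ⟧ℚ
    ⟦⟧ℚ-⊗₃ p r s = trans (⟦⟧ℚ-⊗ (p ⊗ r) s) (cong (_* ⟦ s ⟧ℚ) (⟦⟧ℚ-⊗ p r))

    ⟦⟧ℚ-⊗₄ : ∀ p r s u → ⟦ p ⊗ r ⊗ s ⊗ u ⟧ℚ ≡ ⟦ p ⟧ℚ * ⟦ r ⟧ℚ * ⟦ s ⟧ℚ * ⟦ u ⟧ℚ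
    ⟦⟧ℚ-⊗₄ p r s u = trans (⟦⟧ℚ-⊗ (p ⊗ r ⊗ s) u) (cong (_* ⟦ u ⟧ℚ) (⟦⟧ℚ-⊗₃ p r s))

    ⟦⟧ℚ-identity : ∀ p r → NormalisesTo0 (p ⊖ r) → ⟦ p ⟧ℚ ≡ ⟦ r ⟧ℚ
    ⟦⟧ℚ-identity p r nf = cong ℤ→ℚ (normalises-to-0⇒≗ p r nf ρ)

    ⟦⟧ℚ-Σ⁵ : ∀ f → ⟦ Σ⁵ f ⟧ℚ ≡ Σ5 (λ ν → ⟦ f ν ⟧ℚ)
    ⟦⟧ℚ-Σ⁵ f = begin
      ℤ→ℚ (y 0F ℤ.+ y 1F ℤ.+ y 2F ℤ.+ y 3F ℤ.+ y 4F)
        ≡⟨ ℤ→ℚ-+ (y 0F ℤ.+ y 1F ℤ.+ y 2F ℤ.+ y 3F) (y 4F) ⟩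
      ℤ→ℚ (y 0F ℤ.+ y 1F ℤ.+ y 2F ℤ.+ y 3F) + ℤ→ℚ (y 4F)
        ≡⟨ cong (_+ ℤ→ℚ (y 4F)) (ℤ→ℚ-+ (y 0F ℤ.+ y 1F ℤ.+ y 2F) (y 3F)) ⟩
      ℤ→ℚ (y 0F ℤ.+ y 1F ℤ.+ y 2F) + ℤ→ℚ (y 3F) + ℤ→ℚ (y 4F)
        ≡⟨ cong (λ z → z + ℤ→ℚ (y 3F) + ℤ→ℚ (y 4F)) (ℤ→ℚ-+ (y 0F ℤ.+ y 1F) (y 2F)) ⟩
      ℤ→ℚ (y 0F ℤ.+ y 1F) + ℤ→ℚ (y 2F) + ℤ→ℚ (y 3F) + ℤ→ℚ (y 4F)
        ≡⟨ cong (λ z → z + ℤ→ℚ (y 2F) + ℤ→ℚ (y 3F) + ℤ→ℚ (y 4F)) (ℤ→ℚ-+ (y 0F) (y 1F)) ⟩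
      Σ5 (λ ν → ⟦ f ν ⟧ℚ)
        ∎
      where
      open ≡-Reasoning
      y : Fin 5 → ℤ
      y ν = ⟦ f ν ⟧ ρ

    Σ⁵-scaled : ∀ {f} c g → (∀ ν → f ν ≡ c * ⟦ g ν ⟧ℚ) → Σ5 f ≡ c * ⟦ Σ⁵ g ⟧ℚ
    Σ⁵-scaled {f} c g f≡ = begin
      Σ5 f                       ≡⟨ Σ5-cong f≡ ⟩
      Σ5 (λ ν → c * ⟦ g ν ⟧ℚ)    ≡⟨ distrib c ⟦ g 0F ⟧ℚ ⟦ g 1F ⟧ℚ ⟦ g 2F ⟧ℚ ⟦ g 3F ⟧ℚ ⟦ g 4F ⟧ℚ ⟩
      c * Σ5 (λ ν → ⟦ g ν ⟧ℚ)    ≡⟨ cong (c *_) (sym (⟦⟧ℚ-Σ⁵ g)) ⟩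
      c * ⟦ Σ⁵ g ⟧ℚ              ∎
      where
      open ≡-Reasoning
      distrib : ∀ c y₀ y₁ y₂ y₃ y₄ →
                c * y₀ + c * y₁ + c * y₂ + c * y₃ + c * y₄ ≡ c * (y₀ + y₁ + y₂ + y₃ + y₄)
      distrib = ℚ-Solver.solve-∀ ringℚ

    Π≢0 : ∀ fs → ⟦ Π fs ⟧ℚ ≢ 0ℚ
    Π≢0 fs = ℤ→ℚ-≢0 (Π-nonzero admissible fs)

    P≡ : ∀ i ℓ → S.P i ℓ ≡ ⟦ E i ℓ ⟧ℚ
    P≡ i ℓ = cong ℤ→ℚ (begin
      eigP q (2 ℕ.+ m) i ℓ
        ≡⟨ eigP-is-eigenmatrix q m i ℓ ⟩
      ⟦ eigenmatrix (Κ (+ (q ℕ.^ suc m) ℤ.+ + 1)) i ℓ ⟧ ρ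
        ≡⟨ cong (λ B → ⟦ eigenmatrix (Κ (B ℤ.+ + 1)) i ℓ ⟧ ρ) (ℤ.pos-* q (q ℕ.^ m)) ⟩
      ⟦ eigenmatrix (Κ (⟦ x ⊗ a ⊕ κ 1 ⟧ ρ)) i ℓ ⟧ ρ
        ≡⟨ sym (eigenmatrix-at-constant (x ⊗ a ⊕ κ 1) ρ i ℓ) ⟩
      ⟦ E i ℓ ⟧ ρ
        ∎)
      where open ≡-Reasoning

    valency≢0 : ∀ ν → ⟦ E 0F ν ⟧ℚ ≢ 0ℚ
    valency≢0 ν = ℤ→ℚ-≢0 (factorisation-nonzero admissible (E 0F ν) (valency-factorises ν))

    k≢0 : ∀ ν → S.k ν ≢ 0ℚ
    k≢0 ν = subst (_≢ 0ℚ) (sym (P≡ 0F ν)) (valency≢0 ν)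

    v≡ : S.v ≡ ⟦ order ⟧ℚ
    v≡ = begin
      Σ5 S.k                   ≡⟨ Σ5-cong (P≡ 0F) ⟩
      Σ5 (λ ν → ⟦ E 0F ν ⟧ℚ)   ≡⟨ sym (⟦⟧ℚ-Σ⁵ (E 0F)) ⟩
      ⟦ Σ⁵ (E 0F) ⟧ℚ           ≡⟨ ⟦⟧ℚ-identity (Σ⁵ (E 0F)) order order-identity ⟩
      ⟦ order ⟧ℚ               ∎
      where open ≡-Reasoning

    v≢0 : S.v ≢ 0ℚ
    v≢0 = subst (_≢ 0ℚ) (sym v≡) (Π≢0 order-factors)

    C : ℚ
    C = ⟦ K₁ ⊗ K₂ ⟧ℚ

    C≢0 : C ≢ 0ℚ
    C≢0 = subst (_≢ 0ℚ) (sym (⟦⟧ℚ-⊗ K₁ K₂)) (*-≢0 (valency≢0 1F) (valency≢0 2F))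

    inv-k : ∀ ℓ → inv (S.k ℓ) ≡ ⟦ cofactor ℓ ⟧ℚ * inv C
    inv-k ℓ = inv-from-product (k≢0 ℓ) C≢0 (begin
      S.k ℓ * ⟦ cofactor ℓ ⟧ℚ        ≡⟨ cong (_* ⟦ cofactor ℓ ⟧ℚ) (P≡ 0F ℓ) ⟩
      ⟦ E 0F ℓ ⟧ℚ * ⟦ cofactor ℓ ⟧ℚ  ≡⟨ sym (⟦⟧ℚ-⊗ (E 0F ℓ) (cofactor ℓ)) ⟩
      ⟦ E 0F ℓ ⊗ cofactor ℓ ⟧ℚ        ≡⟨ ⟦⟧ℚ-identity (E 0F ℓ ⊗ cofactor ℓ) (K₁ ⊗ K₂) (cofactor-identity ℓ) ⟩
      C                               ∎)
      where open ≡-Reasoning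

    norm≡ : ∀ i → (Σ5 λ ℓ → S.P i ℓ * S.P i ℓ * inv (S.k ℓ)) ≡ inv C * ⟦ norm i ⟧ℚ
    norm≡ i = Σ⁵-scaled (inv C) (λ ℓ → E i ℓ ⊗ E i ℓ ⊗ cofactor ℓ) λ ℓ → begin
      S.P i ℓ * S.P i ℓ * inv (S.k ℓ)
        ≡⟨ cong₂ (λ e w → e * e * w) (P≡ i ℓ) (inv-k ℓ) ⟩
      ⟦ E i ℓ ⟧ℚ * ⟦ E i ℓ ⟧ℚ * (⟦ cofactor ℓ ⟧ℚ * inv C)
        ≡⟨ rearrange ⟦ E i ℓ ⟧ℚ ⟦ cofactor ℓ ⟧ℚ (inv C) ⟩
      inv C * (⟦ E i ℓ ⟧ℚ * ⟦ E i ℓ ⟧ℚ * ⟦ cofactor ℓ ⟧ℚ)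
        ≡⟨ cong (inv C *_) (sym (⟦⟧ℚ-⊗₃ (E i ℓ) (E i ℓ) (cofactor ℓ))) ⟩
      inv C * ⟦ E i ℓ ⊗ E i ℓ ⊗ cofactor ℓ ⟧ℚ
        ∎
      where
      open ≡-Reasoning
      rearrange : ∀ e w c⁻¹ → e * e * (w * c⁻¹) ≡ c⁻¹ * (e * e * w)
      rearrange = ℚ-Solver.solve-∀ ringℚ

    D≢0 : ⟦ D ⟧ℚ ≢ 0ℚ
    D≢0 = Π≢0 D-factors

    mult≡ : ∀ ν → S.m ν ≡ ⟦ M ν ⟧ℚ * inv ⟦ D ⟧ℚ
    mult≡ ν = cross-division {s = norm-sum} {r = ⟦ M ν ⟧ℚ} v≢0 D≢0 (begin
      norm-sum * ⟦ M ν ⟧ℚ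
        ≡⟨ cong (_* ⟦ M ν ⟧ℚ) (norm≡ ν) ⟩
      inv C * ⟦ norm ν ⟧ℚ * ⟦ M ν ⟧ℚ
        ≡⟨ ℚ.*-assoc (inv C) ⟦ norm ν ⟧ℚ ⟦ M ν ⟧ℚ ⟩
      inv C * (⟦ norm ν ⟧ℚ * ⟦ M ν ⟧ℚ)
        ≡⟨ cong (inv C *_) (sym (⟦⟧ℚ-⊗ (norm ν) (M ν))) ⟩
      inv C * ⟦ norm ν ⊗ M ν ⟧ℚ
        ≡⟨ cong (inv C *_) (⟦⟧ℚ-identity (norm ν ⊗ M ν) (order ⊗ (K₁ ⊗ K₂) ⊗ D) (multiplicity-identity ν)) ⟩
      inv C * ⟦ order ⊗ (K₁ ⊗ K₂) ⊗ D ⟧ℚ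
        ≡⟨ cong (inv C *_) (⟦⟧ℚ-⊗₃ order (K₁ ⊗ K₂) D) ⟩
      inv C * (⟦ order ⟧ℚ * C * ⟦ D ⟧ℚ)
        ≡⟨ rearrange (inv C) ⟦ order ⟧ℚ C ⟦ D ⟧ℚ ⟩
      C * inv C * (⟦ order ⟧ℚ * ⟦ D ⟧ℚ)
        ≡⟨ cong (_* (⟦ order ⟧ℚ * ⟦ D ⟧ℚ)) (*-inv C C≢0) ⟩
      1ℚ * (⟦ order ⟧ℚ * ⟦ D ⟧ℚ)
        ≡⟨ ℚ.*-identityˡ (⟦ order ⟧ℚ * ⟦ D ⟧ℚ) ⟩
      ⟦ order ⟧ℚ * ⟦ D ⟧ℚ
        ≡⟨ cong (_* ⟦ D ⟧ℚ) (sym v≡) ⟩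
      S.v * ⟦ D ⟧ℚ
        ∎)
      where
      open ≡-Reasoning
      norm-sum : ℚ
      norm-sum = Σ5 λ ℓ → S.P ν ℓ * S.P ν ℓ * inv (S.k ℓ)
      rearrange : ∀ c⁻¹ o c d → c⁻¹ * (o * c * d) ≡ c * c⁻¹ * (o * d)
      rearrange = ℚ-Solver.solve-∀ ringℚ

    mult≢0 : ∀ ν → S.m ν ≢ 0ℚ
    mult≢0 ν = subst (_≢ 0ℚ) (sym (mult≡ ν)) (*-≢0 (Π≢0 (M-factors ν)) (inv-≢0 D≢0))

    kr≡ : ∀ i j h → S.kr i j h ≡ inv (S.v * S.m h) * (S.m i * S.m j * S.m h * (inv C * inv C))
                                 * ⟦ krein (i , j , h) ⟧ℚ
    kr≡ i j h = trans (cong (inv (S.v * S.m h) *_) sum≡) (sym (ℚ.*-assoc (inv (S.v * S.m h)) c _))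
      where
      open ≡-Reasoning
      mᵢmⱼmₕ c : ℚ
      mᵢmⱼmₕ = S.m i * S.m j * S.m h
      c = mᵢmⱼmₕ * (inv C * inv C)
      t : Fin 5 → Poly
      t = triple-term (λ ν → cofactor ν ⊗ cofactor ν) E (i , j , h)
      extract : ∀ k k⁻¹ mᵢ mⱼ mₕ pᵢ pⱼ pₕ →
                k * (mᵢ * pᵢ * k⁻¹) * (mⱼ * pⱼ * k⁻¹) * (mₕ * pₕ * k⁻¹)
                ≡ k * k⁻¹ * (mᵢ * mⱼ * mₕ * (k⁻¹ * k⁻¹) * (pᵢ * pⱼ * pₕ))
      extract = ℚ-Solver.solve-∀ ringℚ
      collect : ∀ μ w c⁻¹ eᵢ eⱼ eₕ →
                μ * ((w * c⁻¹) * (w * c⁻¹)) * (eᵢ * eⱼ * eₕ) ≡ μ * (c⁻¹ * c⁻¹) * (w * w * eᵢ * eⱼ * eₕ)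
      collect = ℚ-Solver.solve-∀ ringℚ
      term≡ : ∀ ν → S.k ν * S.Qm ν i * S.Qm ν j * S.Qm ν h ≡ c * ⟦ t ν ⟧ℚ
      term≡ ν = begin
        S.k ν * S.Qm ν i * S.Qm ν j * S.Qm ν h
          ≡⟨ extract (S.k ν) (inv (S.k ν)) (S.m i) (S.m j) (S.m h) (S.P i ν) (S.P j ν) (S.P h ν) ⟩
        S.k ν * inv (S.k ν) * rest
          ≡⟨ cong (_* rest) (*-inv (S.k ν) (k≢0 ν)) ⟩
        1ℚ * rest
          ≡⟨ ℚ.*-identityˡ rest ⟩
        mᵢmⱼmₕ * (inv (S.k ν) * inv (S.k ν)) * (S.P i ν * S.P j ν * S.P h ν)
          ≡⟨ cong₂ (λ w p → mᵢmⱼmₕ * (w * w) * p) (inv-k ν)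
                   (cong₂ _*_ (cong₂ _*_ (P≡ i ν) (P≡ j ν)) (P≡ h ν)) ⟩
        mᵢmⱼmₕ * ((⟦ cofactor ν ⟧ℚ * inv C) * (⟦ cofactor ν ⟧ℚ * inv C)) * (eᵢ * eⱼ * eₕ)
          ≡⟨ collect mᵢmⱼmₕ ⟦ cofactor ν ⟧ℚ (inv C) eᵢ eⱼ eₕ ⟩
        c * (⟦ cofactor ν ⟧ℚ * ⟦ cofactor ν ⟧ℚ * eᵢ * eⱼ * eₕ)
          ≡⟨ cong (λ w → c * (w * eᵢ * eⱼ * eₕ)) (sym (⟦⟧ℚ-⊗ (cofactor ν) (cofactor ν))) ⟩
        c * (⟦ cofactor ν ⊗ cofactor ν ⟧ℚ * eᵢ * eⱼ * eₕ)
          ≡⟨ cong (c *_) (sym (⟦⟧ℚ-⊗₄ (cofactor ν ⊗ cofactor ν) (E i ν) (E j ν) (E h ν))) ⟩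
        c * ⟦ t ν ⟧ℚ
          ∎
        where
        rest : ℚ
        rest = mᵢmⱼmₕ * (inv (S.k ν) * inv (S.k ν)) * (S.P i ν * S.P j ν * S.P h ν)
        eᵢ eⱼ eₕ : ℚ
        eᵢ = ⟦ E i ν ⟧ℚ
        eⱼ = ⟦ E j ν ⟧ℚ
        eₕ = ⟦ E h ν ⟧ℚ
      sum≡ : Σ5 (λ ν → S.k ν * S.Qm ν i * S.Qm ν j * S.Qm ν h) ≡ c * ⟦ krein (i , j , h) ⟧ℚ
      sum≡ = Σ⁵-scaled c t term≡

    p≡ : ∀ i j h → S.p i j h ≡ inv (S.v * S.k h) * inv ⟦ D ⟧ℚ * ⟦ intersection (i , j , h) ⟧ℚ
    p≡ i j h = trans (cong (inv (S.v * S.k h) *_) sum≡) (sym (ℚ.*-assoc (inv (S.v * S.k h)) (inv ⟦ D ⟧ℚ) _))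
      where
      t : Fin 5 → Poly
      t = triple-term M (λ i ν → E ν i) (i , j , h)
      collect : ∀ μ d⁻¹ eᵢ eⱼ eₕ → μ * d⁻¹ * eᵢ * eⱼ * eₕ ≡ d⁻¹ * (μ * eᵢ * eⱼ * eₕ)
      collect = ℚ-Solver.solve-∀ ringℚ
      term≡ : ∀ ν → S.m ν * S.P ν i * S.P ν j * S.P ν h ≡ inv ⟦ D ⟧ℚ * ⟦ t ν ⟧ℚ
      term≡ ν = trans (cong₂ _*_ (cong₂ _*_ (cong₂ _*_ (mult≡ ν) (P≡ ν i)) (P≡ ν j)) (P≡ ν h))
                (trans (collect ⟦ M ν ⟧ℚ (inv ⟦ D ⟧ℚ) ⟦ E ν i ⟧ℚ ⟦ E ν j ⟧ℚ ⟦ E ν h ⟧ℚ)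
                       (cong (inv ⟦ D ⟧ℚ *_) (sym (⟦⟧ℚ-⊗₄ (M ν) (E ν i) (E ν j) (E ν h)))))
      sum≡ : Σ5 (λ ν → S.m ν * S.P ν i * S.P ν j * S.P ν h) ≡ inv ⟦ D ⟧ℚ * ⟦ intersection (i , j , h) ⟧ℚ
      sum≡ = Σ⁵-scaled (inv ⟦ D ⟧ℚ) t term≡

    kr-vanishing : ∀ i j h → S.kr i j h ≡ 0ℚ ⇔ ⟦ krein (sort (i , j , h)) ⟧ ρ ≡ + 0
    kr-vanishing i j h =
      subst (λ z → S.kr i j h ≡ 0ℚ ⇔ z ≡ + 0)
            (sym (triple-sum-sort (λ ν → cofactor ν ⊗ cofactor ν) E ρ (i , j , h)))
            (scaled-vanishing scale≢0 (kr≡ i j h))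
      where
      scale≢0 : inv (S.v * S.m h) * (S.m i * S.m j * S.m h * (inv C * inv C)) ≢ 0ℚ
      scale≢0 = *-≢0 (inv-≢0 (*-≢0 v≢0 (mult≢0 h)))
                     (*-≢0 (*-≢0 (*-≢0 (mult≢0 i) (mult≢0 j)) (mult≢0 h))
                           (*-≢0 (inv-≢0 C≢0) (inv-≢0 C≢0)))

    p-vanishing : ∀ i j h → S.p i j h ≡ 0ℚ ⇔ ⟦ intersection (sort (i , j , h)) ⟧ ρ ≡ + 0
    p-vanishing i j h =
      subst (λ z → S.p i j h ≡ 0ℚ ⇔ z ≡ + 0) (sym (triple-sum-sort M (λ i ν → E ν i) ρ (i , j , h)))
            (scaled-vanishing (*-≢0 (inv-≢0 (*-≢0 v≢0 (k≢0 h))) (inv-≢0 D≢0)) (p≡ i j h))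

    krein-zeros-vanish : All (λ t → ⟦ krein t ⟧ ρ ≡ + 0) krein-zeros
    krein-zeros-vanish = All.map (λ {t} nf → normalises-to-0⇒vanishes (krein t) nf ρ) krein-vanishes

    krein-nonzeros-nonzero : All (λ t → ⟦ krein t ⟧ ρ ≢ + 0) krein-nonzeros
    krein-nonzeros-nonzero = All.map (λ {t} → factorisation-nonzero admissible (krein t)) krein-factorises

    krein-114≡ : ⟦ krein (1F , 1F , 4F) ⟧ ρ ≡ ⟦ a ⊖ x ⟧ ρ ℤ.* ⟦ Π krein-114-factors ⟧ ρ
    krein-114≡ = normalises-to-0⇒≗ (krein (1F , 1F , 4F)) ((a ⊖ x) ⊗ Π krein-114-factors) krein-114 ρ

  intersection-realised : Realises S.p intersection-zeros intersection-nonzeros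
  intersection-realised = realises (λ t → ⟦ intersection t ⟧ ρ) p-vanishing
    (All.map (λ {t} nf → normalises-to-0⇒vanishes (intersection t) nf ρ) intersection-vanishes)
    (All.map (λ {t} → factorisation-nonzero admissible (intersection t)) intersection-factorises)

  krein-realised-if-a≡x : ⟦ a ⊖ x ⟧ ρ ≡ + 0 →
                          Realises S.kr ((1F , 1F , 4F) ∷ krein-zeros) krein-nonzeros
  krein-realised-if-a≡x a≡x = realises (λ t → ⟦ krein t ⟧ ρ) kr-vanishing
    (trans krein-114≡ (cong (ℤ._* ⟦ Π krein-114-factors ⟧ ρ) a≡x) ∷ krein-zeros-vanish)
    krein-nonzeros-nonzero

  krein-realised-if-a≢x : ⟦ a ⊖ x ⟧ ρ ≢ + 0 →
                          Realises S.kr krein-zeros ((1F , 1F , 4F) ∷ krein-nonzeros)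
  krein-realised-if-a≢x a≢x = realises (λ t → ⟦ krein t ⟧ ρ) kr-vanishing krein-zeros-vanish
    ((λ 114≡0 → *-≢0ℤ a≢x (Π-nonzero admissible krein-114-factors) (trans (sym krein-114≡) 114≡0))
     ∷ krein-nonzeros-nonzero)

-- The theorem, for q = 3 + s and n = 3 + t

intersection-pattern-excludes-all : NoCompatibleOrdering intersection-zeros intersection-nonzeros
intersection-pattern-excludes-all = from-yes (no-compatible-ordering? intersection-zeros intersection-nonzeros)

krein-pattern-excludes-all : NoCompatibleOrdering krein-zeros ((1F , 1F , 4F) ∷ krein-nonzeros)
krein-pattern-excludes-all = from-yes (no-compatible-ordering? krein-zeros ((1F , 1F , 4F) ∷ krein-nonzeros))

krein-pattern-forces-identity : OnlyIdentityCompatible ((1F , 1F , 4F) ∷ krein-zeros) krein-nonzeros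
krein-pattern-forces-identity = from-yes (only-identity-compatible? ((1F , 1F , 4F) ∷ krein-zeros) krein-nonzeros)

krein-pattern-supports-identity : SupportsIdentity ((1F , 1F , 4F) ∷ krein-zeros) krein-nonzeros
krein-pattern-supports-identity = from-yes (supports-identity? ((1F , 1F , 4F) ∷ krein-zeros) krein-nonzeros)

q≤q^[1+m] : ∀ s m → 3 ℕ.+ s ≤ (3 ℕ.+ s) ℕ.^ suc m
q≤q^[1+m] s m = ℕ.m≤m*n (3 ℕ.+ s) ((3 ℕ.+ s) ℕ.^ m) {{ℕ.>-nonZero (ℕ.m^n>0 (3 ℕ.+ s) m)}}

coordinates-point : ∀ s m →
  coordinates (3 ℕ.+ s) (suc m) ≡ point s ((3 ℕ.+ s) ℕ.^ suc m ℕ.∸ (3 ℕ.+ s))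
coordinates-point s m = cong (λ A → + (3 ℕ.+ s) ∷ + A ∷ []) (sym (ℕ.m+[n∸m]≡n (q≤q^[1+m] s m)))

admissible-coordinates : ∀ s m → Admissible (coordinates (3 ℕ.+ s) (suc m))
admissible-coordinates s m = subst Admissible (sym (coordinates-point s m)) (admissible-point s _)

a-x-at-coordinates : ∀ s m →
  ⟦ a ⊖ x ⟧ (coordinates (3 ℕ.+ s) (suc m)) ≡ + ((3 ℕ.+ s) ℕ.^ suc m ℕ.∸ (3 ℕ.+ s))
a-x-at-coordinates s m = trans (cong ⟦ a ⊖ x ⟧ (coordinates-point s m)) (a-x-at-point s _)

a≡x-for-n≡3 : ∀ s → ⟦ a ⊖ x ⟧ (coordinates (3 ℕ.+ s) 1) ≡ + 0
a≡x-for-n≡3 s = trans (a-x-at-coordinates s 0)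
  (cong +_ (trans (cong (ℕ._∸ (3 ℕ.+ s)) (ℕ.*-identityʳ (3 ℕ.+ s))) (ℕ.n∸n≡0 (3 ℕ.+ s))))

a≢x-for-n>3 : ∀ s t → ⟦ a ⊖ x ⟧ (coordinates (3 ℕ.+ s) (2 ℕ.+ t)) ≢ + 0
a≢x-for-n>3 s t a≡x =
  ℕ.m>n⇒m∸n≢0 q<q^[2+t] (ℤ.+-injective (trans (sym (a-x-at-coordinates s (suc t))) a≡x))
  where
  q<q^[2+t] : 3 ℕ.+ s < (3 ℕ.+ s) ℕ.^ (2 ℕ.+ t)
  q<q^[2+t] = ℕ.m<m*n (3 ℕ.+ s) ((3 ℕ.+ s) ℕ.^ suc t) (ℕ.<-≤-trans (s≤s (s≤s z≤n)) (q≤q^[1+m] s t))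

not-metric : ∀ s t σ → FixesZero σ → ¬ Metric (3 ℕ.+ s) (3 ℕ.+ t) σ
not-metric s t σ σ0 = no-ordering σ σ0 intersection-realised intersection-pattern-excludes-all
  where open SchemeAt (3 ℕ.+ s) (suc t) (admissible-coordinates s t)

identity-cometric : ∀ s → Cometric (3 ℕ.+ s) 3 id
identity-cometric s =
  identity-ordered (krein-realised-if-a≡x (a≡x-for-n≡3 s)) krein-pattern-supports-identity
  where open SchemeAt (3 ℕ.+ s) 1 (admissible-coordinates s 0)

cometric-ordering-is-identity : ∀ s σ → FixesZero σ → Cometric (3 ℕ.+ s) 3 σ →
                                ∀ i → σ ⟨$⟩ʳ i ≡ i
cometric-ordering-is-identity s σ σ0 =
  only-identity σ σ0 (krein-realised-if-a≡x (a≡x-for-n≡3 s)) krein-pattern-forces-identity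
  where open SchemeAt (3 ℕ.+ s) 1 (admissible-coordinates s 0)

cometric⇒n≡3 : ∀ s t σ → FixesZero σ → Cometric (3 ℕ.+ s) (3 ℕ.+ t) σ → 3 ℕ.+ t ≡ 3
cometric⇒n≡3 s zero    σ σ0 _        = refl
cometric⇒n≡3 s (suc t) σ σ0 cometric =
  ⊥-elim (no-ordering σ σ0 (krein-realised-if-a≢x (a≢x-for-n>3 s t)) krein-pattern-excludes-all cometric)
  where open SchemeAt (3 ℕ.+ s) (2 ℕ.+ t) (admissible-coordinates s (suc t))

lemma7p4 : (q n : ℕ) → IsPrimePower q → 2 < q → 3 ≤ n →
    ((σ : Permutation′ 5) → FixesZero σ → ¬ Metric q n σ)
    × ((Σ (Permutation′ 5) λ σ → FixesZero σ × Cometric q n σ) ⇔ (n ≡ 3))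
    × (n ≡ 3 → Cometric q n id
             × ((σ : Permutation′ 5) → FixesZero σ → Cometric q n σ →
                  (i : Fin 5) → σ ⟨$⟩ʳ i ≡ i))
lemma7p4 q n _ (s≤s (s≤s (s≤s (z≤n {s})))) (s≤s (s≤s (s≤s (z≤n {t})))) =
    not-metric s t
  , mk⇔ (λ (σ , σ0 , cometric) → cometric⇒n≡3 s t σ σ0 cometric)
        (λ { refl → id , refl , identity-cometric s })
  , λ { refl → identity-cometric s , cometric-ordering-is-identity s }
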